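{- Let $\lambda\ge 1$ and let $\pi$ be a ranking of $\mathcal{C}$ whose Kemeny score with respect to $\Pi$ is at most $\lambda\cdot k_{OPT}(\Pi)$. Then for every candidate $c\in\mathcal{C}$, $p_{avg}(c)-\lambda d\le \pi(c)\le p_{avg}(c)+\lambda d$.
   Context: Let $\mathcal{C}$ be a set of candidates and $\Pi$ a multiset of $n\ge2$ rankings (complete linear orders) of $\mathcal{C}$. For a ranking $v$ and candidate $c$, $v(c)=|\{c'\in\mathcal{C}: c'\succ_v c\}|$ is the position of $c$ in $v$; in particular $\pi(c)$ is the position of $c$ in $\pi$. The average position is $p_{avg}(c)=\frac1n\sum_{v\in\Pi}v(c)$. The Kendall-Tau distance $d_{KT}(v,w)$ is the number of pairs of candidates that two rankings order differently, and $d=\frac{\sum_{v\in\Pi}\sum_{w\in\Pi}d_{KT}(v,w)}{n(n-1)}$ is the average Kendall-Tau distance. The Kemeny score of a ranking $Q$ is $\sum_{v\in\Pi}d_{KT}(Q,v)$, and $k_{OPT}(\Pi)$ is its minimum over all rankings of $\mathcal{C}$.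
   Formalization: The approximation factor λ ranges over the rationals rather than the reals. -}

module Defs where

open import Data.Nat using (ℕ; zero; suc; _<ᵇ_)
open import Data.Bool using (Bool; true; false; _xor_; if_then_else_)
open import Data.Fin using (Fin; toℕ)
open import Data.Fin.Permutation using (Permutation′; _⟨$⟩ʳ_)
open import Data.List using (List; map; allFin; concatMap)
open import Data.Nat.ListAction using (sum)
open import Data.Vec using (Vec; toList)
open import Data.Integer using (+_)
open import Data.Rational using (ℚ; _/_; 0ℚ)
open import Data.Product using (Σ; _×_)
open import Relation.Binary.PropositionalEquality using (_≡_)

-- Candidates are Fin m.  A ranking is a bijection from candidates to
-- positions 0..m-1; position v c = number of candidates ranked above c.
Ranking : ℕ → Set
Ranking m = Permutation′ m

pos : ∀ {m} → Ranking m → Fin m → ℕ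
pos v c = toℕ (v ⟨$⟩ʳ c)

dKT : ∀ {m} → Ranking m → Ranking m → ℕ
dKT {m} v w =
  sum (concatMap (λ a → map (λ b →
         if toℕ a <ᵇ toℕ b
         then (if (pos v a <ᵇ pos v b) xor (pos w a <ᵇ pos w b) then 1 else 0)
         else 0) (allFin m)) (allFin m))

-- A profile Π is a multiset of n rankings, represented as a vector.
Profile : ℕ → ℕ → Set
Profile m n = Vec (Ranking m) n

kemenyScore : ∀ {m n} → Profile m n → Ranking m → ℕ
kemenyScore Π Q = sum (map (dKT Q) (toList Π))

IsKOPT : ∀ {m n} → Profile m n → ℕ → Set
IsKOPT {m} Π k = Σ (Ranking m) (λ Q → kemenyScore Π Q ≡ k)
               × ((Q : Ranking m) → k ≤′ kemenyScore Π Q)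
  where open import Data.Nat using () renaming (_≤_ to _≤′_)

-- a / b as a rational (b = 0 never occurs in use since n ≥ 2).
_÷ℕ_ : ℕ → ℕ → ℚ
a ÷ℕ zero = 0ℚ
a ÷ℕ suc b = (+ a) / suc b

pavg : ∀ {m n} → Profile m n → Fin m → ℚ
pavg {n = n} Π c = sum (map (λ v → pos v c) (toList Π)) ÷ℕ n

avgKT : ∀ {m n} → Profile m n → ℚ
avgKT {n = n} Π =
  sum (concatMap (λ v → map (λ w → dKT v w) (toList Π)) (toList Π))
    ÷ℕ (n Data.Nat.* (n Data.Nat.∸ 1))
  where import Data.Nat

{-# OPTIONS --safe #-}
-- A candidate ranked above c by π but not by v forms a discordant pair with c, so
-- π(c) ≤ v(c) + d_KT(π, v), and symmetrically; hence |π(c) − v(c)| ≤ d_KT(π, v).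
-- Summing over Π gives |n·π(c) − Σ_v v(c)| ≤ K(π) ≤ λ·k_OPT.  Every voter v is itself a
-- candidate consensus, so n·k_OPT ≤ Σ_v K(v) = n(n−1)·d and hence λ·k_OPT/n ≤ λ·d.
module Submission where

open import Defs
open import Data.Bool using (Bool; true; false; not; _xor_; if_then_else_)
open import Data.Bool.Properties using (xor-comm)
open import Data.Empty using (⊥-elim)
open import Data.Fin using (Fin; toℕ; zero; suc; punchIn)
open import Data.Fin.Permutation using (_⟨$⟩ʳ_; _⟨$⟩ˡ_; inverseˡ)
import Data.Fin.Properties as Fin
open import Data.Integer as ℤ using (+≤+)
import Data.Integer.Properties as ℤ
open import Data.List using (List; []; _∷_; map; allFin; concatMap; tabulate; length)
open import Data.Nat using (ℕ; zero; suc; _+_; _*_; _∸_; _≤_; _<_; _<ᵇ_; z≤n; s≤s; z<s; s<s)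
open import Data.Nat.ListAction using (sum)
open import Data.Nat.ListAction.Properties using (sum-++)
open import Data.Nat.Properties
open import Data.Product using (_×_; _,_)
open import Data.Rational as ℚ using (ℚ; _/_; 1ℚ; NonNegative) renaming (_≤_ to _≤ℚ_)
import Data.Rational.Properties as ℚ
open import Data.Rational.Unnormalised as ℚᵘ using (mkℚᵘ; *≤*; *≡*)
import Data.Rational.Unnormalised.Properties as ℚᵘ
open import Data.Vec using (toList)
open import Data.Vec.Properties using (length-toList)
open import Function using (_∘_; id)
open import Relation.Binary using (tri<; tri≈; tri>)
open import Relation.Binary.PropositionalEquality
open import Algebra.Properties.CommutativeSemigroup +-commutativeSemigroup using (interchange)
open import Algebra.Properties.CommutativeMonoid.Sum +-0-commutativeMonoid
  using (sum-remove; ∑-distrib-+; sum-cong-≗; sum-permute; sum-replicate-zero)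
  renaming (sum to ∑)

𝟙 : Bool → ℕ
𝟙 b = if b then 1 else 0

∑-mono-≤ : ∀ {m} {f g : Fin m → ℕ} → (∀ i → f i ≤ g i) → ∑ f ≤ ∑ g
∑-mono-≤ {zero}  f≤g = z≤n
∑-mono-≤ {suc m} f≤g = +-mono-≤ (f≤g zero) (∑-mono-≤ (f≤g ∘ suc))

term≤∑ : ∀ {m} (f : Fin m → ℕ) i → f i ≤ ∑ f
term≤∑ {suc m} f i = subst (f i ≤_) (sym (sum-remove {i = i} f)) (m≤m+n (f i) _)

column+row≤∑∑ : ∀ {m} (g : Fin m → Fin m → ℕ) c → g c c ≡ 0 →
  ∑ (λ a → g a c) + ∑ (g c) ≤ ∑ (λ a → ∑ (g a))
column+row≤∑∑ {suc m} g c gcc≡0 = begin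
  ∑ column + ∑ (g c)
    ≡⟨ cong (_+ ∑ (g c)) (sum-remove {i = c} column) ⟩
  (g c c + ∑ (column ∘ punchIn c)) + ∑ (g c)
    ≡⟨ cong (λ x → (x + ∑ (column ∘ punchIn c)) + ∑ (g c)) gcc≡0 ⟩
  ∑ (column ∘ punchIn c) + ∑ (g c)
    ≤⟨ +-monoˡ-≤ (∑ (g c)) (∑-mono-≤ (λ i → term≤∑ (g (punchIn c i)) c)) ⟩
  ∑ (rows ∘ punchIn c) + ∑ (g c)
    ≡⟨ +-comm _ (∑ (g c)) ⟩
  ∑ (g c) + ∑ (rows ∘ punchIn c)
    ≡⟨ sum-remove {i = c} rows ⟨
  ∑ rows ∎
  where
  open ≤-Reasoning
  column rows : Fin (suc m) → ℕ
  column a = g a c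
  rows a = ∑ (g a)

∑-𝟙-<ᵇ : ∀ m t → t ≤ m → ∑ {m} (λ j → 𝟙 (toℕ j <ᵇ t)) ≡ t
∑-𝟙-<ᵇ m       zero    _         = sum-replicate-zero m
∑-𝟙-<ᵇ (suc m) (suc t) (s≤s t≤m) = cong suc (∑-𝟙-<ᵇ m t t≤m)

module _ {A : Set} where

  sum-concatMap : ∀ (f : A → List ℕ) xs → sum (concatMap f xs) ≡ sum (map (sum ∘ f) xs)
  sum-concatMap f []       = refl
  sum-concatMap f (x ∷ xs) = trans (sum-++ (f x) (concatMap f xs)) (cong (sum (f x) +_) (sum-concatMap f xs))

  sum-map-mono-≤ : ∀ {f g : A → ℕ} → (∀ x → f x ≤ g x) → ∀ xs → sum (map f xs) ≤ sum (map g xs)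
  sum-map-mono-≤ f≤g []       = z≤n
  sum-map-mono-≤ f≤g (x ∷ xs) = +-mono-≤ (f≤g x) (sum-map-mono-≤ f≤g xs)

  sum-map-+ : ∀ (f g : A → ℕ) xs → sum (map (λ x → f x + g x) xs) ≡ sum (map f xs) + sum (map g xs)
  sum-map-+ f g []       = refl
  sum-map-+ f g (x ∷ xs) = trans (cong (f x + g x +_) (sum-map-+ f g xs)) (interchange (f x) (g x) _ _)

  sum-map-const : ∀ k (xs : List A) → sum (map (λ _ → k) xs) ≡ length xs * k
  sum-map-const k []       = refl
  sum-map-const k (x ∷ xs) = cong (k +_) (sum-map-const k xs)

sum-map-tabulate : ∀ {A : Set} m (g : A → ℕ) (f : Fin m → A) →
  sum (map g (tabulate f)) ≡ ∑ (g ∘ f)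
sum-map-tabulate zero    g f = refl
sum-map-tabulate (suc m) g f = cong (g (f zero) +_) (sum-map-tabulate m g (f ∘ suc))

sum-map-allFin : ∀ m (g : Fin m → ℕ) → sum (map g (allFin m)) ≡ ∑ g
sum-map-allFin m g = sum-map-tabulate m g id

<ᵇ-true : ∀ {m n} → m < n → (m <ᵇ n) ≡ true
<ᵇ-true {zero}  {suc n} z<s       = refl
<ᵇ-true {suc m} {suc n} (s<s m<n) = <ᵇ-true m<n

<ᵇ-false : ∀ {m n} → n ≤ m → (m <ᵇ n) ≡ false
<ᵇ-false {m}     {zero}  z≤n       = refl
<ᵇ-false {suc m} {suc n} (s≤s n≤m) = <ᵇ-false n≤m

<ᵇ-flip : ∀ {m n} → m ≢ n → (m <ᵇ n) ≡ not (n <ᵇ m)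
<ᵇ-flip {m} {n} m≢n with <-cmp m n
... | tri< m<n _   _   rewrite <ᵇ-true m<n | <ᵇ-false (<⇒≤ m<n) = refl
... | tri≈ _   m≡n _   = ⊥-elim (m≢n m≡n)
... | tri> _   _   n<m rewrite <ᵇ-true n<m | <ᵇ-false (<⇒≤ n<m) = refl

not-xor-not : ∀ p q → (not p xor not q) ≡ (p xor q)
not-xor-not true  q     = refl
not-xor-not false true  = refl
not-xor-not false false = refl

𝟙≤𝟙+𝟙-xor : ∀ p q → 𝟙 p ≤ 𝟙 q + 𝟙 (p xor q)
𝟙≤𝟙+𝟙-xor true  true  = s≤s z≤n
𝟙≤𝟙+𝟙-xor true  false = s≤s z≤n
𝟙≤𝟙+𝟙-xor false q     = z≤n

pos≡∑ : ∀ {m} (σ : Ranking m) c → pos σ c ≡ ∑ (λ a → 𝟙 (pos σ a <ᵇ pos σ c))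
pos≡∑ {m} σ c = trans (sym (∑-𝟙-<ᵇ m (pos σ c) (<⇒≤ (Fin.toℕ<n _)))) (sum-permute _ σ)

pos-injective : ∀ {m} (σ : Ranking m) {a c} → pos σ a ≡ pos σ c → a ≡ c
pos-injective σ {a} {c} eq = begin
  a                             ≡⟨ inverseˡ σ ⟨
  σ ⟨$⟩ˡ (σ ⟨$⟩ʳ a)             ≡⟨ cong (σ ⟨$⟩ˡ_) (Fin.toℕ-injective eq) ⟩
  σ ⟨$⟩ˡ (σ ⟨$⟩ʳ c)             ≡⟨ inverseˡ σ ⟩
  c                             ∎
  where open ≡-Reasoning

module _ {m} (π v : Ranking m) where

  disagree : Fin m → Fin m → Bool
  disagree a b = (pos π a <ᵇ pos π b) xor (pos v a <ᵇ pos v b)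

  discordant : Fin m → Fin m → ℕ
  discordant a b = if toℕ a <ᵇ toℕ b then 𝟙 (disagree a b) else 0

  dKT≡∑∑ : dKT π v ≡ ∑ (λ a → ∑ (discordant a))
  dKT≡∑∑ = begin
    dKT π v
      ≡⟨ sum-concatMap (λ a → map (discordant a) (allFin m)) (allFin m) ⟩
    sum (map (λ a → sum (map (discordant a) (allFin m))) (allFin m))
      ≡⟨ sum-map-allFin m (λ a → sum (map (discordant a) (allFin m))) ⟩
    ∑ (λ a → sum (map (discordant a) (allFin m)))
      ≡⟨ sum-cong-≗ (λ a → sum-map-allFin m (discordant a)) ⟩
    ∑ (λ a → ∑ (discordant a))
      ∎
    where open ≡-Reasoning

  disagree-sym : ∀ {a c} → a ≢ c → disagree a c ≡ disagree c a
  disagree-sym {a} {c} a≢c =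
    trans (cong₂ _xor_ (<ᵇ-flip (a≢c ∘ pos-injective π)) (<ᵇ-flip (a≢c ∘ pos-injective v)))
          (not-xor-not (pos π c <ᵇ pos π a) (pos v c <ᵇ pos v a))

  𝟙-disagree≤discordant : ∀ a c → 𝟙 (disagree a c) ≤ discordant a c + discordant c a
  𝟙-disagree≤discordant a c with <-cmp (toℕ a) (toℕ c)
  ... | tri< a<c _ _ rewrite <ᵇ-true a<c = m≤m+n _ _
  ... | tri> _ a≢c c<a rewrite <ᵇ-true c<a | <ᵇ-false (<⇒≤ c<a)
                             | disagree-sym (a≢c ∘ cong toℕ) = ≤-refl
  ... | tri≈ _ a≡c _ rewrite Fin.toℕ-injective a≡c
                           | <ᵇ-false (≤-refl {pos π c}) | <ᵇ-false (≤-refl {pos v c}) = z≤n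

  ∑-𝟙-disagree≤dKT : ∀ c → ∑ (λ a → 𝟙 (disagree a c)) ≤ dKT π v
  ∑-𝟙-disagree≤dKT c = begin
    ∑ (λ a → 𝟙 (disagree a c))                      ≤⟨ ∑-mono-≤ (λ a → 𝟙-disagree≤discordant a c) ⟩
    ∑ (λ a → discordant a c + discordant c a)       ≡⟨ ∑-distrib-+ (λ a → discordant a c) (discordant c) ⟩
    ∑ (λ a → discordant a c) + ∑ (discordant c)     ≤⟨ column+row≤∑∑ discordant c discordant-diagonal ⟩
    ∑ (λ a → ∑ (discordant a))                      ≡⟨ dKT≡∑∑ ⟨
    dKT π v                                         ∎
    where
    open ≤-Reasoning
    discordant-diagonal : discordant c c ≡ 0
    discordant-diagonal rewrite <ᵇ-false (≤-refl {toℕ c}) = refl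

  pos≤pos+dKT : ∀ c → pos π c ≤ pos v c + dKT π v
  pos≤pos+dKT c = begin
    pos π c
      ≡⟨ pos≡∑ π c ⟩
    ∑ (λ a → 𝟙 (pos π a <ᵇ pos π c))
      ≤⟨ ∑-mono-≤ (λ a → 𝟙≤𝟙+𝟙-xor (pos π a <ᵇ pos π c) (pos v a <ᵇ pos v c)) ⟩
    ∑ (λ a → 𝟙 (pos v a <ᵇ pos v c) + 𝟙 (disagree a c))
      ≡⟨ ∑-distrib-+ (λ a → 𝟙 (pos v a <ᵇ pos v c)) (λ a → 𝟙 (disagree a c)) ⟩
    ∑ (λ a → 𝟙 (pos v a <ᵇ pos v c)) + ∑ (λ a → 𝟙 (disagree a c))
      ≤⟨ +-mono-≤ (≤-reflexive (sym (pos≡∑ v c))) (∑-𝟙-disagree≤dKT c) ⟩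
    pos v c + dKT π v
      ∎
    where open ≤-Reasoning

discordant-comm : ∀ {m} (π v : Ranking m) a b → discordant π v a b ≡ discordant v π a b
discordant-comm π v a b = cong (λ x → if toℕ a <ᵇ toℕ b then 𝟙 x else 0)
                               (xor-comm (pos π a <ᵇ pos π b) (pos v a <ᵇ pos v b))

dKT-sym : ∀ {m} (π v : Ranking m) → dKT π v ≡ dKT v π
dKT-sym {m} π v = begin
  dKT π v                         ≡⟨ dKT≡∑∑ π v ⟩
  ∑ (λ a → ∑ (discordant π v a))  ≡⟨ sum-cong-≗ {m} (λ a → sum-cong-≗ {m} (discordant-comm π v a)) ⟩
  ∑ (λ a → ∑ (discordant v π a))  ≡⟨ dKT≡∑∑ v π ⟨
  dKT v π                         ∎
  where open ≡-Reasoning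

module _ {m n} (Π : Profile m n) where

  totalPos : Fin m → ℕ
  totalPos c = sum (map (λ v → pos v c) (toList Π))

  totalKT : ℕ
  totalKT = sum (concatMap (λ v → map (λ w → dKT v w) (toList Π)) (toList Π))

  sum-map-const-profile : ∀ k → sum (map (λ _ → k) (toList Π)) ≡ n * k
  sum-map-const-profile k = trans (sum-map-const k (toList Π)) (cong (_* k) (length-toList Π))

  n*pos≤totalPos+kemenyScore : ∀ π c → n * pos π c ≤ totalPos c + kemenyScore Π π
  n*pos≤totalPos+kemenyScore π c = begin
    n * pos π c                                              ≡⟨ sum-map-const-profile (pos π c) ⟨
    sum (map (λ _ → pos π c) (toList Π))                     ≤⟨ sum-map-mono-≤ (λ v → pos≤pos+dKT π v c) (toList Π) ⟩
    sum (map (λ v → pos v c + dKT π v) (toList Π))           ≡⟨ sum-map-+ (λ v → pos v c) (dKT π) (toList Π) ⟩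
    totalPos c + kemenyScore Π π                             ∎
    where open ≤-Reasoning

  totalPos≤n*pos+kemenyScore : ∀ π c → totalPos c ≤ n * pos π c + kemenyScore Π π
  totalPos≤n*pos+kemenyScore π c = begin
    totalPos c                                               ≤⟨ sum-map-mono-≤ pos≤pos+dKT-swap (toList Π) ⟩
    sum (map (λ v → pos π c + dKT π v) (toList Π))           ≡⟨ sum-map-+ (λ _ → pos π c) (dKT π) (toList Π) ⟩
    sum (map (λ _ → pos π c) (toList Π)) + kemenyScore Π π   ≡⟨ cong (_+ kemenyScore Π π) (sum-map-const-profile (pos π c)) ⟩
    n * pos π c + kemenyScore Π π                            ∎
    where
    open ≤-Reasoning
    pos≤pos+dKT-swap : ∀ v → pos v c ≤ pos π c + dKT π v
    pos≤pos+dKT-swap v = subst (λ d → pos v c ≤ pos π c + d) (dKT-sym v π) (pos≤pos+dKT v π c)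

  n*kOPT≤totalKT : ∀ k → (∀ Q → k ≤ kemenyScore Π Q) → n * k ≤ totalKT
  n*kOPT≤totalKT k k≤kemenyScore = begin
    n * k                                          ≡⟨ sum-map-const-profile k ⟨
    sum (map (λ _ → k) (toList Π))                 ≤⟨ sum-map-mono-≤ k≤kemenyScore (toList Π) ⟩
    sum (map (kemenyScore Π) (toList Π))           ≡⟨ sum-concatMap (λ v → map (dKT v) (toList Π)) (toList Π) ⟨
    totalKT                                        ∎
    where open ≤-Reasoning

  kOPT*n[n∸1]≤totalKT*n : ∀ k → (∀ Q → k ≤ kemenyScore Π Q) → k * (n * (n ∸ 1)) ≤ totalKT * n
  kOPT*n[n∸1]≤totalKT*n k k≤kemenyScore = begin
    k * (n * (n ∸ 1))   ≡⟨ *-assoc k n (n ∸ 1) ⟨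
    k * n * (n ∸ 1)     ≡⟨ cong (_* (n ∸ 1)) (*-comm k n) ⟩
    n * k * (n ∸ 1)     ≤⟨ *-monoˡ-≤ (n ∸ 1) (n*kOPT≤totalKT k k≤kemenyScore) ⟩
    totalKT * (n ∸ 1)   ≤⟨ *-monoʳ-≤ totalKT (m∸n≤m n 1) ⟩
    totalKT * n         ∎
    where open ≤-Reasoning

toℚᵘ-÷ℕ : ∀ a d → ℚ.toℚᵘ (a ÷ℕ suc d) ℚᵘ.≃ mkℚᵘ (ℤ.+ a) d
toℚᵘ-÷ℕ a d = ℚ.toℚᵘ-fromℚᵘ (mkℚᵘ (ℤ.+ a) d)

÷ℕ-mono-≤ : ∀ a b {d e} → a * suc e ≤ b * suc d → a ÷ℕ suc d ≤ℚ b ÷ℕ suc e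
÷ℕ-mono-≤ a b {d} {e} ae≤bd = ℚ.toℚᵘ-cancel-≤ (begin
  ℚ.toℚᵘ (a ÷ℕ suc d)  ≃⟨ toℚᵘ-÷ℕ a d ⟩
  mkℚᵘ (ℤ.+ a) d       ≤⟨ *≤* (subst₂ ℤ._≤_ (ℤ.pos-* a (suc e)) (ℤ.pos-* b (suc d)) (+≤+ ae≤bd)) ⟩
  mkℚᵘ (ℤ.+ b) e       ≃⟨ toℚᵘ-÷ℕ b e ⟨
  ℚ.toℚᵘ (b ÷ℕ suc e)  ∎)
  where open ℚᵘ.≤-Reasoning

÷ℕ-monoˡ-≤ : ∀ {a b} d → a ≤ b → a ÷ℕ suc d ≤ℚ b ÷ℕ suc d
÷ℕ-monoˡ-≤ {a} {b} d a≤b = ÷ℕ-mono-≤ a b (*-monoˡ-≤ (suc d) a≤b)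

*÷ℕ-cancelˡ : ∀ a d → (suc d * a) ÷ℕ suc d ≡ a ÷ℕ 1
*÷ℕ-cancelˡ a d = ℚ.≤-antisym (÷ℕ-mono-≤ (suc d * a) a (≤-reflexive eq))
                               (÷ℕ-mono-≤ a (suc d * a) (≤-reflexive (sym eq)))
  where eq : suc d * a * 1 ≡ a * suc d
        eq = trans (*-identityʳ (suc d * a)) (*-comm (suc d) a)

÷ℕ-distrib-+ : ∀ a b d → (a + b) ÷ℕ suc d ≡ a ÷ℕ suc d ℚ.+ b ÷ℕ suc d
÷ℕ-distrib-+ a b d = ℚ.toℚᵘ-injective (begin
  ℚ.toℚᵘ ((a + b) ÷ℕ suc d)                         ≈⟨ toℚᵘ-÷ℕ (a + b) d ⟩
  mkℚᵘ (ℤ.+ (a + b)) d                              ≈⟨ *≡* cross-multiplied ⟩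
  mkℚᵘ (ℤ.+ a) d ℚᵘ.+ mkℚᵘ (ℤ.+ b) d                ≈⟨ ℚᵘ.+-cong (toℚᵘ-÷ℕ a d) (toℚᵘ-÷ℕ b d) ⟨
  ℚ.toℚᵘ (a ÷ℕ suc d) ℚᵘ.+ ℚ.toℚᵘ (b ÷ℕ suc d)      ≈⟨ ℚ.toℚᵘ-homo-+ (a ÷ℕ suc d) (b ÷ℕ suc d) ⟨
  ℚ.toℚᵘ (a ÷ℕ suc d ℚ.+ b ÷ℕ suc d)                ∎)
  where
  open import Relation.Binary.Reasoning.Setoid ℚᵘ.≃-setoid
  open import Data.Integer.Solver using (module +-*-Solver)
  open +-*-Solver
  cross-multiplied : ℤ.+ (a + b) ℤ.* ℤ.+ (suc d * suc d)
                   ≡ (ℤ.+ a ℤ.* ℤ.+ suc d ℤ.+ ℤ.+ b ℤ.* ℤ.+ suc d) ℤ.* ℤ.+ suc d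
  cross-multiplied = trans (cong₂ ℤ._*_ (ℤ.pos-+ a b) (ℤ.pos-* (suc d) (suc d)))
    (solve 3 (λ a b d → (a :+ b) :* (d :* d) := (a :* d :+ b :* d) :* d) refl (ℤ.+ a) (ℤ.+ b) (ℤ.+ suc d))

÷ℕ-homo-* : ∀ a b d → a ÷ℕ 1 ℚ.* b ÷ℕ suc d ≡ (a * b) ÷ℕ suc d
÷ℕ-homo-* a b d = ℚ.toℚᵘ-injective (begin
  ℚ.toℚᵘ (a ÷ℕ 1 ℚ.* b ÷ℕ suc d)                    ≈⟨ ℚ.toℚᵘ-homo-* (a ÷ℕ 1) (b ÷ℕ suc d) ⟩
  ℚ.toℚᵘ (a ÷ℕ 1) ℚᵘ.* ℚ.toℚᵘ (b ÷ℕ suc d)          ≈⟨ ℚᵘ.*-cong (toℚᵘ-÷ℕ a 0) (toℚᵘ-÷ℕ b d) ⟩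
  mkℚᵘ (ℤ.+ a) 0 ℚᵘ.* mkℚᵘ (ℤ.+ b) d                ≈⟨ *≡* cross-multiplied ⟩
  mkℚᵘ (ℤ.+ (a * b)) d                              ≈⟨ toℚᵘ-÷ℕ (a * b) d ⟨
  ℚ.toℚᵘ ((a * b) ÷ℕ suc d)                         ∎)
  where
  open import Relation.Binary.Reasoning.Setoid ℚᵘ.≃-setoid
  cross-multiplied : (ℤ.+ a ℤ.* ℤ.+ b) ℤ.* ℤ.+ suc d ≡ ℤ.+ (a * b) ℤ.* ℤ.+ suc (d + 0)
  cross-multiplied = cong₂ ℤ._*_ (sym (ℤ.pos-* a b)) (cong (ℤ.+_ ∘ suc) (sym (+-identityʳ d)))

p≤r+q⇒p-q≤r : ∀ {p q r} → p ≤ℚ r ℚ.+ q → p ℚ.- q ≤ℚ r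
p≤r+q⇒p-q≤r {p} {q} {r} p≤r+q = begin
  p ℚ.- q                  ≤⟨ ℚ.+-monoˡ-≤ (ℚ.- q) p≤r+q ⟩
  r ℚ.+ q ℚ.- q            ≡⟨ ℚ.+-assoc r q (ℚ.- q) ⟩
  r ℚ.+ (q ℚ.- q)          ≡⟨ cong (r ℚ.+_) (ℚ.+-inverseʳ q) ⟩
  r ℚ.+ ℚ.0ℚ               ≡⟨ ℚ.+-identityʳ r ⟩
  r                        ∎
  where open ℚ.≤-Reasoning

-- In the application x = π(c), p = Σ_v v(c), κ = K(π), k = k_OPT, t = Σ_{v,w} d_KT(v,w)
-- and suc M = n(n−1).
module _ (lam : ℚ) .{{_ : NonNegative lam}} where

  κ/n≤lam*t/M : ∀ κ k t {n M} → κ ÷ℕ 1 ≤ℚ lam ℚ.* k ÷ℕ 1 → k * suc M ≤ t * suc n →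
                κ ÷ℕ suc n ≤ℚ lam ℚ.* t ÷ℕ suc M
  κ/n≤lam*t/M κ k t {n} {M} κ≤lam*k kM≤tn = begin
    κ ÷ℕ suc n                               ≡⟨ ÷ℕ≡*1/n κ ⟩
    κ ÷ℕ 1 ℚ.* 1 ÷ℕ suc n                    ≤⟨ ℚ.*-monoʳ-≤-nonNeg (1 ÷ℕ suc n) {{ℚ.normalize-nonNeg 1 (suc n)}} κ≤lam*k ⟩
    lam ℚ.* k ÷ℕ 1 ℚ.* 1 ÷ℕ suc n            ≡⟨ ℚ.*-assoc lam (k ÷ℕ 1) (1 ÷ℕ suc n) ⟩
    lam ℚ.* (k ÷ℕ 1 ℚ.* 1 ÷ℕ suc n)          ≡⟨ cong (lam ℚ.*_) (÷ℕ≡*1/n k) ⟨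
    lam ℚ.* k ÷ℕ suc n                       ≤⟨ ℚ.*-monoˡ-≤-nonNeg lam (÷ℕ-mono-≤ k t kM≤tn) ⟩
    lam ℚ.* t ÷ℕ suc M                       ∎
    where
    open ℚ.≤-Reasoning
    ÷ℕ≡*1/n : ∀ a → a ÷ℕ suc n ≡ a ÷ℕ 1 ℚ.* 1 ÷ℕ suc n
    ÷ℕ≡*1/n a = trans (cong (_÷ℕ suc n) (sym (*-identityʳ a))) (sym (÷ℕ-homo-* a 1 n))

  x≤p/n+lam*t/M : ∀ x p κ k t {n M} → suc n * x ≤ p + κ →
                  κ ÷ℕ 1 ≤ℚ lam ℚ.* k ÷ℕ 1 → k * suc M ≤ t * suc n →
                  x ÷ℕ 1 ≤ℚ p ÷ℕ suc n ℚ.+ lam ℚ.* t ÷ℕ suc M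
  x≤p/n+lam*t/M x p κ k t {n} nx≤p+κ κ≤lam*k kM≤tn = begin
    x ÷ℕ 1                                   ≤⟨ ÷ℕ-mono-≤ x (p + κ) x*n≤[p+κ]*1 ⟩
    (p + κ) ÷ℕ suc n                         ≡⟨ ÷ℕ-distrib-+ p κ n ⟩
    p ÷ℕ suc n ℚ.+ κ ÷ℕ suc n                ≤⟨ ℚ.+-monoʳ-≤ (p ÷ℕ suc n) (κ/n≤lam*t/M κ k t κ≤lam*k kM≤tn) ⟩
    p ÷ℕ suc n ℚ.+ lam ℚ.* t ÷ℕ suc _        ∎
    where
    open ℚ.≤-Reasoning
    x*n≤[p+κ]*1 : x * suc n ≤ (p + κ) * 1
    x*n≤[p+κ]*1 rewrite *-comm x (suc n) | *-identityʳ (p + κ) = nx≤p+κ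

  p/n≤x+lam*t/M : ∀ x p κ k t {n M} → p ≤ suc n * x + κ →
                  κ ÷ℕ 1 ≤ℚ lam ℚ.* k ÷ℕ 1 → k * suc M ≤ t * suc n →
                  p ÷ℕ suc n ≤ℚ x ÷ℕ 1 ℚ.+ lam ℚ.* t ÷ℕ suc M
  p/n≤x+lam*t/M x p κ k t {n} p≤nx+κ κ≤lam*k kM≤tn = begin
    p ÷ℕ suc n                               ≤⟨ ÷ℕ-monoˡ-≤ n p≤nx+κ ⟩
    (suc n * x + κ) ÷ℕ suc n                 ≡⟨ ÷ℕ-distrib-+ (suc n * x) κ n ⟩
    (suc n * x) ÷ℕ suc n ℚ.+ κ ÷ℕ suc n      ≡⟨ cong (ℚ._+ κ ÷ℕ suc n) (*÷ℕ-cancelˡ x n) ⟩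
    x ÷ℕ 1 ℚ.+ κ ÷ℕ suc n                    ≤⟨ ℚ.+-monoʳ-≤ (x ÷ℕ 1) (κ/n≤lam*t/M κ k t κ≤lam*k kM≤tn) ⟩
    x ÷ℕ 1 ℚ.+ lam ℚ.* t ÷ℕ suc _            ∎
    where open ℚ.≤-Reasoning

lemma1 : ∀ {m n} (Π : Profile m n) → 2 ≤ n →
    (lam : ℚ) → 1ℚ ≤ℚ lam →
    (k : ℕ) → IsKOPT Π k →
    (π : Ranking m) → (ℤ.+ kemenyScore Π π) / 1 ≤ℚ lam ℚ.* ((ℤ.+ k) / 1) →
    (c : Fin m) →
      (pavg Π c ℚ.- lam ℚ.* avgKT Π ≤ℚ (ℤ.+ pos π c) / 1)
      × ((ℤ.+ pos π c) / 1 ≤ℚ pavg Π c ℚ.+ lam ℚ.* avgKT Π)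
lemma1 {n = suc (suc n)} Π (s≤s (s≤s z≤n)) lam 1≤lam k (_ , kOPT≤kemenyScore) π kemenyScore≤lam*k c =
    p≤r+q⇒p-q≤r (p/n≤x+lam*t/M lam (pos π c) (totalPos Π c) (kemenyScore Π π) k (totalKT Π)
                   (totalPos≤n*pos+kemenyScore Π π c) kemenyScore≤lam*k kOPT*M≤totalKT*n)
  , x≤p/n+lam*t/M lam (pos π c) (totalPos Π c) (kemenyScore Π π) k (totalKT Π)
      (n*pos≤totalPos+kemenyScore Π π c) kemenyScore≤lam*k kOPT*M≤totalKT*n
  where
  instance
    lam≥0 : NonNegative lam
    lam≥0 = ℚ.nonNegative (ℚ.≤-trans (ℚ.nonNegative⁻¹ 1ℚ) 1≤lam)
  kOPT*M≤totalKT*n : k * (suc (suc n) * suc n) ≤ totalKT Π * suc (suc n)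
  kOPT*M≤totalKT*n = kOPT*n[n∸1]≤totalKT*n Π k kOPT≤kemenyScore
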